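{- Let $n$ be a positive integer. Then for any $i,j\in\{0,\ldots,n-1\}$, $$\sum_{k=0}^{n-1}\binom ki\binom{k+j}j=\frac{(-1)^jn}{i+j+1}\binom{n-1}i\binom{ -n-1}j$$ and $$\sum_{k=0}^{n-1}(2k+1)\binom ki\binom{k+j}j=(-1)^j\binom{n-1}i\binom{ -n-1}j\,n\left(\frac{2n}{i+j+2}+\frac{i-j}{(i+j+1)(i+j+2)}\right).$$
   Context: $\binom xk=x(x-1)\cdots(x-k+1)/k!$ for $k\in\{0,1,2,\ldots\}$ and any $x$ (so e.g. $\binom{ -n-1}{j}$ is defined this way). -}

module Defs where

open import Data.Nat as ℕ using (ℕ; zero; suc; _!)
open import Data.Nat.Properties using (_!≢0)
open import Data.Integer as ℤ using (ℤ)
open import Data.Rational using (ℚ; 0ℚ; 1ℚ; _+_; _*_; _-_; -_; _/_)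

ℕtoℚ : ℕ → ℚ
ℕtoℚ n = ℤ.+ n / 1

_^ℚ_ : ℚ → ℕ → ℚ
x ^ℚ zero = 1ℚ
x ^ℚ suc k = x * (x ^ℚ k)

falling : ℚ → ℕ → ℚ
falling x zero = 1ℚ
falling x (suc k) = falling x k * (x - ℕtoℚ k)

binom : ℚ → ℕ → ℚ
binom x k = falling x k * ((ℤ.+ 1 / (k !)) {{k !≢0}})

sumBelow : ℕ → (ℕ → ℚ) → ℚ
sumBelow zero f = 0ℚ
sumBelow (suc n) f = sumBelow n f + f n

module Submission where

-- Both sums are evaluated by "discrete integration".  With
--   P x = C(x, i) C(x+j, j)   and   Φ x = x C(x-1, i) C(x+j, j)
-- the absorption identity  x C(x-1, k) = (x-k) C(x, k)  gives, for every
-- rational x,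
--   Φ x = (x-i) P x   and   Φ (x+1) = (x+j+1) P x,
-- hence  Φ (x+1) - Φ x = m P x  with  m = i+j+1.  Likewise
--   Ψ x = (2m x + i - j) Φ x   satisfies   Ψ (x+1) - Ψ x = m(m+1)(2x+1) P x.
-- Summing these differences over x = 0, …, n-1 (where Φ 0 = Ψ 0 = 0) gives
--   Σ P k = Φ n / m   and   Σ (2k+1) P k = Ψ n / (m(m+1)),
-- and upper negation  (-1)^j C(-n-1, j) = C(n+j, j)  turns these into the
-- stated right-hand sides.

open import Defs
open import Data.Nat as ℕ using (ℕ; suc; _<_; NonZero)
open import Data.Integer as ℤ using ()
open import Data.Rational using (ℚ; 1ℚ; _+_; _*_; _-_; -_; _/_)
open import Data.Product using (_×_)
open import Relation.Binary.PropositionalEquality using (_≡_)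

open import Data.Nat using (zero; _!)
open import Data.Nat.Properties using (_!≢0)
import Data.Integer.Properties as ℤP
open import Data.Product using (_,_)
open import Data.Rational using (0ℚ; toℚᵘ; fromℚᵘ)
open import Data.Rational.Properties
  using ( toℚᵘ-injective; toℚᵘ-fromℚᵘ; fromℚᵘ-cong; toℚᵘ-homo-+; toℚᵘ-homo-*
        ; +-comm; *-assoc; *-zeroˡ; *-zeroʳ; *-identityˡ; *-identityʳ; *-distribˡ-+ )
import Data.Rational.Unnormalised as ℚᵘ
import Data.Rational.Unnormalised.Properties as ℚᵘP
open import Data.Rational.Solver using (module +-*-Solver)
open +-*-Solver using (solve; _:+_; _:*_; _:-_; :-_; _:=_; con)
open import Relation.Binary.PropositionalEquality using (refl; sym; trans; cong; cong₂; module ≡-Reasoning)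
open ≡-Reasoning

-- fromℚᵘ respects + and *, since toℚᵘ does and toℚᵘ ∘ fromℚᵘ ≃ id.
fromℚᵘ-homo-+ : ∀ p q → fromℚᵘ (p ℚᵘ.+ q) ≡ fromℚᵘ p + fromℚᵘ q
fromℚᵘ-homo-+ p q = toℚᵘ-injective (begin-≃
    toℚᵘ (fromℚᵘ (p ℚᵘ.+ q))             ≈⟨ toℚᵘ-fromℚᵘ (p ℚᵘ.+ q) ⟩
    p ℚᵘ.+ q                              ≈⟨ ℚᵘP.+-cong (ℚᵘP.≃-sym (toℚᵘ-fromℚᵘ p)) (ℚᵘP.≃-sym (toℚᵘ-fromℚᵘ q)) ⟩
    toℚᵘ (fromℚᵘ p) ℚᵘ.+ toℚᵘ (fromℚᵘ q)  ≈⟨ ℚᵘP.≃-sym (toℚᵘ-homo-+ (fromℚᵘ p) (fromℚᵘ q)) ⟩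
    toℚᵘ (fromℚᵘ p + fromℚᵘ q)            ∎≃)
  where open ℚᵘP.≃-Reasoning renaming (begin_ to begin-≃_; _∎ to _∎≃)

fromℚᵘ-homo-* : ∀ p q → fromℚᵘ (p ℚᵘ.* q) ≡ fromℚᵘ p * fromℚᵘ q
fromℚᵘ-homo-* p q = toℚᵘ-injective (begin-≃
    toℚᵘ (fromℚᵘ (p ℚᵘ.* q))             ≈⟨ toℚᵘ-fromℚᵘ (p ℚᵘ.* q) ⟩
    p ℚᵘ.* q                              ≈⟨ ℚᵘP.*-cong (ℚᵘP.≃-sym (toℚᵘ-fromℚᵘ p)) (ℚᵘP.≃-sym (toℚᵘ-fromℚᵘ q)) ⟩
    toℚᵘ (fromℚᵘ p) ℚᵘ.* toℚᵘ (fromℚᵘ q)  ≈⟨ ℚᵘP.≃-sym (toℚᵘ-homo-* (fromℚᵘ p) (fromℚᵘ q)) ⟩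
    toℚᵘ (fromℚᵘ p * fromℚᵘ q)            ∎≃)
  where open ℚᵘP.≃-Reasoning renaming (begin_ to begin-≃_; _∎ to _∎≃)

-- n as an unnormalised rational; ℕtoℚ n is definitionally fromℚᵘ (ℕtoℚᵘ n).
ℕtoℚᵘ : ℕ → ℚᵘ.ℚᵘ
ℕtoℚᵘ n = ℚᵘ.mkℚᵘ (ℤ.+ n) 0

-- ℕtoℚ is additive and multiplicative: over the common denominator 1 only
-- the numerators need comparing, and ℕ → ℤ is a semiring map.
ℕtoℚ-+ : ∀ m n → ℕtoℚ (m ℕ.+ n) ≡ ℕtoℚ m + ℕtoℚ n
ℕtoℚ-+ m n =
  trans (fromℚᵘ-cong {ℕtoℚᵘ (m ℕ.+ n)} {ℕtoℚᵘ m ℚᵘ.+ ℕtoℚᵘ n} (ℚᵘ.*≡* (cong (ℤ._* ℤ.+ 1) numerators)))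
        (fromℚᵘ-homo-+ (ℕtoℚᵘ m) (ℕtoℚᵘ n))
  where
  numerators : ℤ.+ (m ℕ.+ n) ≡ ℤ.+ m ℤ.* ℤ.+ 1 ℤ.+ ℤ.+ n ℤ.* ℤ.+ 1
  numerators = trans (ℤP.pos-+ m n)
                     (sym (cong₂ ℤ._+_ (ℤP.*-identityʳ (ℤ.+ m)) (ℤP.*-identityʳ (ℤ.+ n))))

ℕtoℚ-* : ∀ m n → ℕtoℚ (m ℕ.* n) ≡ ℕtoℚ m * ℕtoℚ n
ℕtoℚ-* m n =
  trans (fromℚᵘ-cong {ℕtoℚᵘ (m ℕ.* n)} {ℕtoℚᵘ m ℚᵘ.* ℕtoℚᵘ n} (ℚᵘ.*≡* (cong (ℤ._* ℤ.+ 1) (ℤP.pos-* m n))))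
        (fromℚᵘ-homo-* (ℕtoℚᵘ m) (ℕtoℚᵘ n))

ℕtoℚ-suc : ∀ n → ℕtoℚ (suc n) ≡ 1ℚ + ℕtoℚ n
ℕtoℚ-suc = ℕtoℚ-+ 1

ℕtoℚ-double : ∀ n → ℕtoℚ (2 ℕ.* n) ≡ ℕtoℚ n + ℕtoℚ n
ℕtoℚ-double n = trans (ℕtoℚ-* 2 n) (solve 1 (λ x → (con 1ℚ :+ con 1ℚ) :* x := x :+ x) refl (ℕtoℚ n))

1/n*n≡1 : ∀ n .{{_ : NonZero n}} → (ℤ.+ 1 / n) * ℕtoℚ n ≡ 1ℚ
1/n*n≡1 (suc n) = trans (sym (fromℚᵘ-homo-* (ℚᵘ.1/ p) p)) (fromℚᵘ-cong (ℚᵘP.*-inverseˡ p))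
  where p = ℕtoℚᵘ (suc n)

inverse-of-factor : ∀ e q a b → e * b ≡ 1ℚ → q * (a * b) ≡ 1ℚ → e ≡ a * q
inverse-of-factor e q a b eb≡1 qab≡1 = begin
  e                    ≡⟨ sym (*-identityʳ e) ⟩
  e * 1ℚ               ≡⟨ cong (e *_) (sym qab≡1) ⟩
  e * (q * (a * b))    ≡⟨ solve 4 (λ e q a b → e :* (q :* (a :* b)) := (e :* b) :* (a :* q)) refl e q a b ⟩
  (e * b) * (a * q)    ≡⟨ cong (_* (a * q)) eb≡1 ⟩
  1ℚ * (a * q)         ≡⟨ *-identityˡ (a * q) ⟩
  a * q                ∎

+1-1 : ∀ y → (y + 1ℚ) - 1ℚ ≡ y
+1-1 = solve 1 (λ y → (y :+ con 1ℚ) :- con 1ℚ := y) refl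

falling-peel : ∀ x k → falling x (suc k) ≡ x * falling (x - 1ℚ) k
falling-peel x zero = solve 1 (λ x → con 1ℚ :* (x :- con 0ℚ) := x :* con 1ℚ) refl x
falling-peel x (suc k) = begin
  falling x (suc k) * (x - ℕtoℚ (suc k))        ≡⟨ cong₂ (λ a b → a * (x - b)) (falling-peel x k) (ℕtoℚ-suc k) ⟩
  x * falling (x - 1ℚ) k * (x - (1ℚ + ℕtoℚ k))  ≡⟨ regroup x (falling (x - 1ℚ) k) (ℕtoℚ k) ⟩
  x * falling (x - 1ℚ) (suc k)                  ∎
  where
  regroup : ∀ x f k → x * f * (x - (1ℚ + k)) ≡ x * (f * ((x - 1ℚ) - k))
  regroup = solve 3 (λ x f k → x :* f :* (x :- (con 1ℚ :+ k)) := x :* (f :* ((x :- con 1ℚ) :- k))) refl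

inverseFactorial : ℕ → ℚ
inverseFactorial k = (ℤ.+ 1 / (k !)) {{k !≢0}}

absorption : ∀ x k → x * binom (x - 1ℚ) k ≡ (x - ℕtoℚ k) * binom x k
absorption x k = begin
  x * (falling (x - 1ℚ) k * inverseFactorial k)    ≡⟨ sym (*-assoc x _ _) ⟩
  x * falling (x - 1ℚ) k * inverseFactorial k      ≡⟨ cong (_* inverseFactorial k) (sym (falling-peel x k)) ⟩
  falling x k * (x - ℕtoℚ k) * inverseFactorial k  ≡⟨ rotate (falling x k) (x - ℕtoℚ k) (inverseFactorial k) ⟩
  (x - ℕtoℚ k) * binom x k                         ∎
  where
  rotate : ∀ a b c → a * b * c ≡ b * (a * c)
  rotate = solve 3 (λ a b c → a :* b :* c := b :* (a :* c)) refl

falling-upper-negation : ∀ x j → ((- 1ℚ) ^ℚ j) * falling (- x - 1ℚ) j ≡ falling (x + ℕtoℚ j) j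
falling-upper-negation x zero = refl
falling-upper-negation x (suc j) = begin
  (- 1ℚ * s) * (f * ((- x - 1ℚ) - ℕtoℚ j))  ≡⟨ regroup s f x (ℕtoℚ j) ⟩
  (y + 1ℚ) * (s * f)                         ≡⟨ cong ((y + 1ℚ) *_) (falling-upper-negation x j) ⟩
  (y + 1ℚ) * falling y j                     ≡⟨ cong (λ z → (y + 1ℚ) * falling z j) (sym (+1-1 y)) ⟩
  (y + 1ℚ) * falling ((y + 1ℚ) - 1ℚ) j       ≡⟨ sym (falling-peel (y + 1ℚ) j) ⟩
  falling (y + 1ℚ) (suc j)                   ≡⟨ cong (λ z → falling z (suc j)) (sym x+[1+j]≡y+1) ⟩
  falling (x + ℕtoℚ (suc j)) (suc j)         ∎
  where
  s f y : ℚ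
  s = (- 1ℚ) ^ℚ j
  f = falling (- x - 1ℚ) j
  y = x + ℕtoℚ j
  regroup : ∀ s f x j → (- 1ℚ * s) * (f * ((- x - 1ℚ) - j)) ≡ ((x + j) + 1ℚ) * (s * f)
  regroup = solve 4 (λ s f x j →
    (:- con 1ℚ :* s) :* (f :* ((:- x :- con 1ℚ) :- j)) := ((x :+ j) :+ con 1ℚ) :* (s :* f)) refl
  x+[1+j]≡y+1 : x + ℕtoℚ (suc j) ≡ y + 1ℚ
  x+[1+j]≡y+1 = trans (cong (x +_) (ℕtoℚ-suc j))
                      (solve 2 (λ x j → x :+ (con 1ℚ :+ j) := (x :+ j) :+ con 1ℚ) refl x (ℕtoℚ j))

upper-negation : ∀ x j → ((- 1ℚ) ^ℚ j) * binom (- x - 1ℚ) j ≡ binom (x + ℕtoℚ j) j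
upper-negation x j =
  trans (sym (*-assoc ((- 1ℚ) ^ℚ j) _ _)) (cong (_* inverseFactorial j) (falling-upper-negation x j))

sumBelow-cong : ∀ {f g : ℕ → ℚ} → (∀ k → f k ≡ g k) → ∀ n → sumBelow n f ≡ sumBelow n g
sumBelow-cong f≡g zero = refl
sumBelow-cong f≡g (suc n) = cong₂ _+_ (sumBelow-cong f≡g n) (f≡g n)

sum-of-differences : ∀ (g G : ℚ → ℚ) (c d : ℚ) → c * d ≡ 1ℚ → G 0ℚ ≡ 0ℚ →
  (∀ x → G (x + 1ℚ) ≡ G x + d * g x) →
  ∀ n → sumBelow n (λ k → g (ℕtoℚ k)) ≡ c * G (ℕtoℚ n)
sum-of-differences g G c d cd≡1 G0≡0 step zero = sym (trans (cong (c *_) G0≡0) (*-zeroʳ c))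
sum-of-differences g G c d cd≡1 G0≡0 step (suc n) = begin
  sumBelow n (λ k → g (ℕtoℚ k)) + g x  ≡⟨ cong (_+ g x) (sum-of-differences g G c d cd≡1 G0≡0 step n) ⟩
  c * G x + g x                        ≡⟨ cong (c * G x +_) g≡c*d*g ⟩
  c * G x + c * (d * g x)              ≡⟨ sym (*-distribˡ-+ c (G x) (d * g x)) ⟩
  c * (G x + d * g x)                  ≡⟨ cong (c *_) (sym (step x)) ⟩
  c * G (x + 1ℚ)                       ≡⟨ cong (λ y → c * G y) (trans (+-comm x 1ℚ) (sym (ℕtoℚ-suc n))) ⟩
  c * G (ℕtoℚ (suc n))                 ∎
  where
  x : ℚ
  x = ℕtoℚ n
  g≡c*d*g : g x ≡ c * (d * g x)
  g≡c*d*g = trans (sym (*-identityˡ (g x))) (trans (cong (_* g x) (sym cd≡1)) (*-assoc c d (g x)))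

module Antiderivatives (i j : ℕ) where
  ι κ : ℚ
  ι = ℕtoℚ i
  κ = ℕtoℚ j

  P : ℚ → ℚ
  P x = binom x i * binom (x + κ) j

  Φ : ℚ → ℚ
  Φ x = x * binom (x - 1ℚ) i * binom (x + κ) j

  Φ-lower : ∀ x → Φ x ≡ (x - ι) * P x
  Φ-lower x = trans (cong (_* binom (x + κ) j) (absorption x i)) (*-assoc (x - ι) _ _)

  Φ-upper : ∀ x → Φ (x + 1ℚ) ≡ ((x + 1ℚ) + κ) * P x
  Φ-upper x = begin
    (x + 1ℚ) * binom ((x + 1ℚ) - 1ℚ) i * binom z j  ≡⟨ cong₂ (λ u v → u * binom v i * binom z j) (sym z-κ≡x+1) (+1-1 x) ⟩
    (z - κ) * A * binom z j                          ≡⟨ rotate (z - κ) A (binom z j) ⟩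
    A * ((z - κ) * binom z j)                        ≡⟨ cong (A *_) (sym (absorption z j)) ⟩
    A * (z * binom (z - 1ℚ) j)                       ≡⟨ cong (λ w → A * (z * binom w j)) z-1≡x+κ ⟩
    A * (z * binom (x + κ) j)                        ≡⟨ swap A z (binom (x + κ) j) ⟩
    z * P x                                          ∎
    where
    A z : ℚ
    A = binom x i
    z = (x + 1ℚ) + κ
    z-κ≡x+1 : z - κ ≡ x + 1ℚ
    z-κ≡x+1 = solve 2 (λ x κ → ((x :+ con 1ℚ) :+ κ) :- κ := x :+ con 1ℚ) refl x κ
    z-1≡x+κ : z - 1ℚ ≡ x + κ
    z-1≡x+κ = solve 2 (λ x κ → ((x :+ con 1ℚ) :+ κ) :- con 1ℚ := x :+ κ) refl x κ
    rotate : ∀ a b c → a * b * c ≡ b * (a * c)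
    rotate = solve 3 (λ a b c → a :* b :* c := b :* (a :* c)) refl
    swap : ∀ a b c → a * (b * c) ≡ b * (a * c)
    swap = solve 3 (λ a b c → a :* (b :* c) := b :* (a :* c)) refl

  -- m = i+j+1, the difference of the coefficients of P in Φ-upper and Φ-lower
  m : ℚ
  m = 1ℚ + (ι + κ)

  Φ-difference : ∀ x → Φ (x + 1ℚ) ≡ Φ x + m * P x
  Φ-difference x = begin
    Φ (x + 1ℚ)                ≡⟨ Φ-upper x ⟩
    ((x + 1ℚ) + κ) * P x      ≡⟨ split x ι κ (P x) ⟩
    (x - ι) * P x + m * P x   ≡⟨ cong (_+ m * P x) (sym (Φ-lower x)) ⟩
    Φ x + m * P x             ∎
    where
    split : ∀ x ι κ p → ((x + 1ℚ) + κ) * p ≡ (x - ι) * p + (1ℚ + (ι + κ)) * p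
    split = solve 4 (λ x ι κ p →
      ((x :+ con 1ℚ) :+ κ) :* p := (x :- ι) :* p :+ (con 1ℚ :+ (ι :+ κ)) :* p) refl

  Ψ : ℚ → ℚ
  Ψ x = ((m + m) * x + (ι - κ)) * Φ x

  P₂ : ℚ → ℚ
  P₂ x = ((x + x) + 1ℚ) * P x

  Ψ-difference : ∀ x → Ψ (x + 1ℚ) ≡ Ψ x + (m * (1ℚ + m)) * P₂ x
  Ψ-difference x = begin
    Ψ (x + 1ℚ)                                               ≡⟨ cong (((m + m) * (x + 1ℚ) + (ι - κ)) *_) (Φ-upper x) ⟩
    ((m + m) * (x + 1ℚ) + (ι - κ)) * (((x + 1ℚ) + κ) * P x)  ≡⟨ expand x ι κ (P x) ⟩
    ((m + m) * x + (ι - κ)) * ((x - ι) * P x) + (m * (1ℚ + m)) * P₂ x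
                                 ≡⟨ cong (λ w → ((m + m) * x + (ι - κ)) * w + (m * (1ℚ + m)) * P₂ x) (sym (Φ-lower x)) ⟩
    Ψ x + (m * (1ℚ + m)) * P₂ x                              ∎
    where
    expand : ∀ x ι κ p → let m = 1ℚ + (ι + κ) in
      ((m + m) * (x + 1ℚ) + (ι - κ)) * (((x + 1ℚ) + κ) * p)
        ≡ ((m + m) * x + (ι - κ)) * ((x - ι) * p) + (m * (1ℚ + m)) * (((x + x) + 1ℚ) * p)
    expand = solve 4 (λ x ι κ p → let m = con 1ℚ :+ (ι :+ κ) in
      ((m :+ m) :* (x :+ con 1ℚ) :+ (ι :- κ)) :* (((x :+ con 1ℚ) :+ κ) :* p)
        := ((m :+ m) :* x :+ (ι :- κ)) :* ((x :- ι) :* p) :+ (m :* (con 1ℚ :+ m)) :* (((x :+ x) :+ con 1ℚ) :* p)) refl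

  Φ-zero : Φ 0ℚ ≡ 0ℚ
  Φ-zero = trans (cong (_* binom (0ℚ + κ) j) (*-zeroˡ (binom (0ℚ - 1ℚ) i))) (*-zeroˡ (binom (0ℚ + κ) j))

  Ψ-zero : Ψ 0ℚ ≡ 0ℚ
  Ψ-zero = trans (cong (((m + m) * 0ℚ + (ι - κ)) *_) Φ-zero) (*-zeroʳ ((m + m) * 0ℚ + (ι - κ)))

  c e q : ℚ
  c = ℤ.+ 1 / suc (i ℕ.+ j)
  e = ℤ.+ 1 / suc (suc (i ℕ.+ j))
  q = ℤ.+ 1 / (suc (i ℕ.+ j) ℕ.* suc (suc (i ℕ.+ j)))

  ℕtoℚ-m : ℕtoℚ (suc (i ℕ.+ j)) ≡ m
  ℕtoℚ-m = trans (ℕtoℚ-suc (i ℕ.+ j)) (cong (1ℚ +_) (ℕtoℚ-+ i j))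

  ℕtoℚ-m+1 : ℕtoℚ (suc (suc (i ℕ.+ j))) ≡ 1ℚ + m
  ℕtoℚ-m+1 = trans (ℕtoℚ-suc (suc (i ℕ.+ j))) (cong (1ℚ +_) ℕtoℚ-m)

  c*m≡1 : c * m ≡ 1ℚ
  c*m≡1 = trans (cong (c *_) (sym ℕtoℚ-m)) (1/n*n≡1 (suc (i ℕ.+ j)))

  q*m[m+1]≡1 : q * (m * (1ℚ + m)) ≡ 1ℚ
  q*m[m+1]≡1 = trans (cong (q *_) (sym (trans (ℕtoℚ-* (suc (i ℕ.+ j)) (suc (suc (i ℕ.+ j)))) (cong₂ _*_ ℕtoℚ-m ℕtoℚ-m+1))))
                     (1/n*n≡1 (suc (i ℕ.+ j) ℕ.* suc (suc (i ℕ.+ j))))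

  e≡m*q : e ≡ m * q
  e≡m*q = inverse-of-factor e q m (1ℚ + m)
            (trans (cong (e *_) (sym ℕtoℚ-m+1)) (1/n*n≡1 (suc (suc (i ℕ.+ j))))) q*m[m+1]≡1

  closed-form₁ : ∀ n → ((- 1ℚ) ^ℚ j) * ℕtoℚ n * c * binom (ℕtoℚ n - 1ℚ) i * binom (- ℕtoℚ n - 1ℚ) j
                         ≡ c * Φ (ℕtoℚ n)
  closed-form₁ n = begin
    s * x * c * A′ * B⁻        ≡⟨ solve 5 (λ s x c a b → s :* x :* c :* a :* b := c :* (x :* a :* (s :* b))) refl s x c A′ B⁻ ⟩
    c * (x * A′ * (s * B⁻))    ≡⟨ cong (λ w → c * (x * A′ * w)) (upper-negation x j) ⟩
    c * Φ x                    ∎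
    where
    s x A′ B⁻ : ℚ
    s = (- 1ℚ) ^ℚ j
    x = ℕtoℚ n
    A′ = binom (x - 1ℚ) i
    B⁻ = binom (- x - 1ℚ) j

  closed-form₂ : ∀ n → ((- 1ℚ) ^ℚ j) * binom (ℕtoℚ n - 1ℚ) i * binom (- ℕtoℚ n - 1ℚ) j * ℕtoℚ n
                         * (ℕtoℚ (2 ℕ.* n) * e + (ι - κ) * q)
                         ≡ q * Ψ (ℕtoℚ n)
  closed-form₂ n = begin
    s * A′ * B⁻ * x * (ℕtoℚ (2 ℕ.* n) * e + (ι - κ) * q)
      ≡⟨ cong₂ (λ u v → s * A′ * B⁻ * x * (u * v + (ι - κ) * q)) (ℕtoℚ-double n) e≡m*q ⟩
    s * A′ * B⁻ * x * ((x + x) * (m * q) + (ι - κ) * q)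
      ≡⟨ regroup s A′ B⁻ x m q ι κ ⟩
    q * (((m + m) * x + (ι - κ)) * (x * A′ * (s * B⁻)))
      ≡⟨ cong (λ w → q * (((m + m) * x + (ι - κ)) * (x * A′ * w))) (upper-negation x j) ⟩
    q * Ψ x
      ∎
    where
    s x A′ B⁻ : ℚ
    s = (- 1ℚ) ^ℚ j
    x = ℕtoℚ n
    A′ = binom (x - 1ℚ) i
    B⁻ = binom (- x - 1ℚ) j
    regroup : ∀ s a b x m q ι κ →
      s * a * b * x * ((x + x) * (m * q) + (ι - κ) * q) ≡ q * (((m + m) * x + (ι - κ)) * (x * a * (s * b)))
    regroup = solve 8 (λ s a b x m q ι κ →
      s :* a :* b :* x :* ((x :+ x) :* (m :* q) :+ (ι :- κ) :* q)
        := q :* (((m :+ m) :* x :+ (ι :- κ)) :* (x :* a :* (s :* b)))) refl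

  summand : ∀ k → binom (ℕtoℚ k) i * binom (ℕtoℚ (k ℕ.+ j)) j ≡ P (ℕtoℚ k)
  summand k = cong (λ y → binom (ℕtoℚ k) i * binom y j) (ℕtoℚ-+ k j)

  weighted-summand : ∀ k → ℕtoℚ (2 ℕ.* k ℕ.+ 1) * binom (ℕtoℚ k) i * binom (ℕtoℚ (k ℕ.+ j)) j
                             ≡ P₂ (ℕtoℚ k)
  weighted-summand k = begin
    ℕtoℚ (2 ℕ.* k ℕ.+ 1) * A * B      ≡⟨ cong (λ w → w * A * B) (trans (ℕtoℚ-+ (2 ℕ.* k) 1) (cong (_+ 1ℚ) (ℕtoℚ-double k))) ⟩
    ((x + x) + 1ℚ) * A * B            ≡⟨ *-assoc ((x + x) + 1ℚ) A B ⟩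
    ((x + x) + 1ℚ) * (A * B)          ≡⟨ cong (((x + x) + 1ℚ) *_) (summand k) ⟩
    P₂ x                              ∎
    where
    x A B : ℚ
    x = ℕtoℚ k
    A = binom x i
    B = binom (ℕtoℚ (k ℕ.+ j)) j

lemma2p2 : (n : ℕ) → .{{_ : NonZero n}} → (i j : ℕ) → i < n → j < n →
    (sumBelow n (λ k → binom (ℕtoℚ k) i * binom (ℕtoℚ (k ℕ.+ j)) j)
      ≡ ((- 1ℚ) ^ℚ j) * ℕtoℚ n * (ℤ.+ 1 / suc (i ℕ.+ j))
          * binom (ℕtoℚ n - 1ℚ) i * binom (- ℕtoℚ n - 1ℚ) j)
    × (sumBelow n (λ k → ℕtoℚ (2 ℕ.* k ℕ.+ 1) * binom (ℕtoℚ k) i * binom (ℕtoℚ (k ℕ.+ j)) j)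
      ≡ ((- 1ℚ) ^ℚ j) * binom (ℕtoℚ n - 1ℚ) i * binom (- ℕtoℚ n - 1ℚ) j * ℕtoℚ n
          * (ℕtoℚ (2 ℕ.* n) * (ℤ.+ 1 / suc (suc (i ℕ.+ j)))
             + (ℕtoℚ i - ℕtoℚ j) * (ℤ.+ 1 / (suc (i ℕ.+ j) ℕ.* suc (suc (i ℕ.+ j))))))
lemma2p2 n i j _ _ =
    (begin
      _                                ≡⟨ sumBelow-cong summand n ⟩
      sumBelow n (λ k → P (ℕtoℚ k))    ≡⟨ sum-of-differences P Φ c m c*m≡1 Φ-zero Φ-difference n ⟩
      c * Φ (ℕtoℚ n)                   ≡⟨ sym (closed-form₁ n) ⟩
      _                                ∎)
  , (begin
      _                                ≡⟨ sumBelow-cong weighted-summand n ⟩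
      sumBelow n (λ k → P₂ (ℕtoℚ k))   ≡⟨ sum-of-differences P₂ Ψ q (m * (1ℚ + m)) q*m[m+1]≡1 Ψ-zero Ψ-difference n ⟩
      q * Ψ (ℕtoℚ n)                   ≡⟨ sym (closed-form₂ n) ⟩
      _                                ∎)
  where open Antiderivatives i j
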